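{- For semitables $a(x,y,z)$ and $b(x,y,z)$: $\models\widetilde{\mathit{Sim}}(a(0,0,k),b(\hat0,\tilde0,\tilde k))$ iff $a(x,y,z)$ and $b(x,y,z)$ are the identical semiterm.
   Context: First-order predicate calculus with identity $\doteq$ over a language with countably infinitely many function and predicate symbols of every arity; $\models\theta$ means $\theta$ is true in every structure. The language contains distinct constants $0,\hat0,\tilde0,k,\tilde k$, a unary function symbol $S$ and a binary function symbol $\mathrm{pr}$; $S^0(t)=t$, $S^{m+1}(t)=S(S^m(t))$. Fix distinct variables $x,y,z$. Semitables: $z$ is a semitable; if $a(x,y,z)$ is a semitable and $p,q\ge0$, then $\mathrm{pr}(\mathrm{pr}(S^p(x),S^q(y)),a(x,y,z))$ is a semitable. $\widetilde{\mathit{Sim}}(x,y)$ is the semiformula $0\doteq\hat0\wedge0\doteq\tilde0\wedge k\doteq\tilde k\to x\doteq y$. -}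

module Defs where

open import Data.Nat using (ℕ; zero; suc; _≟_)
open import Data.Vec using (Vec; []; _∷_)
open import Data.Product using (_×_)
open import Data.Empty using (⊥)
open import Relation.Nullary using (yes; no)
open import Relation.Binary.PropositionalEquality using (_≡_)

-- Language: for every arity n, function symbols of arity n are indexed by ℕ
-- (countably infinitely many), and likewise predicate symbols.
-- Variables are indexed by ℕ.

data Term : Set where
  var : ℕ → Term
  fun : (n : ℕ) → ℕ → Vec Term n → Term

c0 c0hat c0tilde ck cktilde : Term
c0      = fun 0 0 []
c0hat   = fun 0 1 []
c0tilde = fun 0 2 []
ck      = fun 0 3 []
cktilde = fun 0 4 []

S : Term → Term
S t = fun 1 0 (t ∷ [])

pr : Term → Term → Term
pr s t = fun 2 0 (s ∷ t ∷ [])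

S^ : ℕ → Term → Term
S^ zero    t = t
S^ (suc m) t = S (S^ m t)

vx vy vz : Term
vx = var 0
vy = var 1
vz = var 2

data IsSemitable : Term → Set where
  st-z  : IsSemitable vz
  st-pr : ∀ {a} (p q : ℕ) → IsSemitable a →
          IsSemitable (pr (pr (S^ p vx) (S^ q vy)) a)

mutual
  sub : (ℕ → Term) → Term → Term
  sub σ (var v)      = σ v
  sub σ (fun n f ts) = fun n f (subs σ ts)

  subs : ∀ {n} → (ℕ → Term) → Vec Term n → Vec Term n
  subs σ []       = []
  subs σ (t ∷ ts) = sub σ t ∷ subs σ ts

-- a(t₁,t₂,t₃): substitute t₁,t₂,t₃ for x,y,z simultaneously.
inst : Term → Term → Term → Term → Term
inst a t₁ t₂ t₃ = sub σ a
  where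
  σ : ℕ → Term
  σ 0 = t₁
  σ 1 = t₂
  σ 2 = t₃
  σ v = var v

data Formula : Set where
  _≐_  : Term → Term → Formula
  rel  : (n : ℕ) → ℕ → Vec Term n → Formula
  ⊥f   : Formula
  _∧f_ : Formula → Formula → Formula
  _⇒_  : Formula → Formula → Formula
  ∀f   : ℕ → Formula → Formula

infix  8 _≐_
infixr 7 _∧f_
infixr 6 _⇒_

record Structure : Set₁ where
  field
    Dom  : Set
    funI : (n : ℕ) → ℕ → Vec Dom n → Dom
    relI : (n : ℕ) → ℕ → Vec Dom n → Set

module _ (M : Structure) where
  open Structure M

  mutual
    eval : (ℕ → Dom) → Term → Dom
    eval ρ (var v)      = ρ v
    eval ρ (fun n f ts) = funI n f (evals ρ ts)

    evals : ∀ {n} → (ℕ → Dom) → Vec Term n → Vec Dom n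
    evals ρ []       = []
    evals ρ (t ∷ ts) = eval ρ t ∷ evals ρ ts

  update : (ℕ → Dom) → ℕ → Dom → ℕ → Dom
  update ρ v d w with w ≟ v
  ... | yes _ = d
  ... | no  _ = ρ w

  Sat : (ℕ → Dom) → Formula → Set
  Sat ρ (s ≐ t)      = eval ρ s ≡ eval ρ t
  Sat ρ (rel n P ts) = relI n P (evals ρ ts)
  Sat ρ ⊥f           = ⊥
  Sat ρ (φ ∧f ψ)     = Sat ρ φ × Sat ρ ψ
  Sat ρ (φ ⇒ ψ)      = Sat ρ φ → Sat ρ ψ
  Sat ρ (∀f v φ)     = (d : Dom) → Sat (update ρ v d) φ

⊨_ : Formula → Set₁
⊨ θ = (M : Structure) (ρ : ℕ → Structure.Dom M) → Sat M ρ θ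

SimT : Term → Term → Formula
SimT s t = (c0 ≐ c0hat ∧f c0 ≐ c0tilde ∧f ck ≐ cktilde) ⇒ s ≐ t

module Submission where

-- Soundness (a ≡ b ⇒ ⊨ Sim~): evaluation of a substitution instance depends
-- only on the values of the substituted terms, so in any structure where
-- 0 = 0̂, 0 = 0̃ and k = k̃ the terms a(0,0,k) and a(0̂,0̃,k̃) have the same
-- value.  This holds for every term a, semitable or not.
--
-- Completeness (⊨ Sim~ ⇒ a ≡ b): evaluate in the "collapsing" term model,
-- whose domain is the set of terms and which interprets 0̂, 0̃ as 0 and k̃ as k
-- and every other symbol freely.  It satisfies the antecedent of Sim~, so the
-- two instances receive equal values; by soundness the value of b(0̂,0̃,k̃)
-- equals that of b(0,0,k); instances of semitables at (0,0,k) evaluate to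
-- themselves; and instantiation at (0,0,k) is injective on semitables,
-- because the exponents p, q are recovered from the numerals Sᵖ(0), S^q(0).

open import Defs
open import Function.Bundles using (_⇔_; mk⇔)
open import Relation.Binary.PropositionalEquality using (_≡_; refl; cong; cong₂; sym; module ≡-Reasoning)
open import Data.Nat using (ℕ; zero; suc)
open import Data.Vec using (Vec; []; _∷_)
open import Data.Product using (_×_; _,_)
open import Data.Empty using (⊥)

inst-S^ : ∀ p t t₁ t₂ t₃ → inst (S^ p t) t₁ t₂ t₃ ≡ S^ p (inst t t₁ t₂ t₃)
inst-S^ zero    t t₁ t₂ t₃ = refl
inst-S^ (suc p) t t₁ t₂ t₃ = cong S (inst-S^ p t t₁ t₂ t₃)

module _ (M : Structure) (ρ : ℕ → Structure.Dom M) where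

  mutual
    eval-sub-cong : ∀ {σ τ} → (∀ v → eval M ρ (σ v) ≡ eval M ρ (τ v)) →
                    ∀ t → eval M ρ (sub σ t) ≡ eval M ρ (sub τ t)
    eval-sub-cong σ≈τ (var v)      = σ≈τ v
    eval-sub-cong σ≈τ (fun n f ts) = cong (Structure.funI M n f) (evals-sub-cong σ≈τ ts)

    evals-sub-cong : ∀ {n σ τ} → (∀ v → eval M ρ (σ v) ≡ eval M ρ (τ v)) →
                     (ts : Vec Term n) → evals M ρ (subs σ ts) ≡ evals M ρ (subs τ ts)
    evals-sub-cong σ≈τ []       = refl
    evals-sub-cong σ≈τ (t ∷ ts) = cong₂ _∷_ (eval-sub-cong σ≈τ t) (evals-sub-cong σ≈τ ts)

  eval-inst-cong : ∀ {t₁ t₂ t₃ u₁ u₂ u₃} →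
    eval M ρ t₁ ≡ eval M ρ u₁ → eval M ρ t₂ ≡ eval M ρ u₂ → eval M ρ t₃ ≡ eval M ρ u₃ →
    ∀ a → eval M ρ (inst a t₁ t₂ t₃) ≡ eval M ρ (inst a u₁ u₂ u₃)
  eval-inst-cong e₁ e₂ e₃ a = eval-sub-cong
    (λ { 0 → e₁ ; 1 → e₂ ; 2 → e₃ ; (suc (suc (suc v))) → refl }) a

sim-sound : ∀ a → ⊨ SimT (inst a c0 c0 ck) (inst a c0hat c0tilde cktilde)
sim-sound a M ρ (e₁ , e₂ , e₃) = eval-inst-cong M ρ e₁ e₂ e₃ a

collapse : (n : ℕ) → ℕ → Vec Term n → Term
collapse zero 1 [] = c0
collapse zero 2 [] = c0
collapse zero 4 [] = ck
collapse n    f ts = fun n f ts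

Collapse : Structure
Collapse = record { Dom = Term ; funI = collapse ; relI = λ _ _ _ → ⊥ }

numeral-fixed : ∀ ρ p → eval Collapse ρ (S^ p c0) ≡ S^ p c0
numeral-fixed ρ zero    = refl
numeral-fixed ρ (suc p) = cong S (numeral-fixed ρ p)

-- Hence so are the instances a(0,0,k) of semitables a, whose only
-- constants are 0 and k.
semitable-fixed : ∀ ρ {a} → IsSemitable a →
                  eval Collapse ρ (inst a c0 c0 ck) ≡ inst a c0 c0 ck
semitable-fixed ρ st-z = refl
semitable-fixed ρ (st-pr {a} p q sa) =
  cong₂ pr (cong₂ pr (numeral-at vx p refl) (numeral-at vy q refl)) (semitable-fixed ρ sa)
  where
  numeral-at : ∀ t p → inst t c0 c0 ck ≡ c0 →
               eval Collapse ρ (inst (S^ p t) c0 c0 ck) ≡ inst (S^ p t) c0 c0 ck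
  numeral-at t p e rewrite inst-S^ p t c0 c0 ck | e = numeral-fixed ρ p

S^-injective : ∀ p q → S^ p c0 ≡ S^ q c0 → p ≡ q
S^-injective zero    zero    _ = refl
S^-injective (suc p) (suc q) e = cong suc (S^-injective p q (S-injective e))
  where
  S-injective : ∀ {s t} → S s ≡ S t → s ≡ t
  S-injective refl = refl

pr-injective : ∀ {s t s′ t′} → pr s t ≡ pr s′ t′ → s ≡ s′ × t ≡ t′
pr-injective refl = refl , refl

inst-injective : ∀ {a b} → IsSemitable a → IsSemitable b →
                 inst a c0 c0 ck ≡ inst b c0 c0 ck → a ≡ b
inst-injective st-z st-z _ = refl
inst-injective st-z (st-pr p q sb) ()
inst-injective (st-pr p q sa) st-z ()
inst-injective (st-pr p q sa) (st-pr p′ q′ sb) e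
  with pr-injective e
... | e-head , e-tail with pr-injective e-head
... | e-x , e-y =
  cong₂ pr (cong₂ (λ m n → pr (S^ m vx) (S^ n vy))
                  (exponent vx p p′ e-x refl) (exponent vy q q′ e-y refl))
           (inst-injective sa sb e-tail)
  where
  exponent : ∀ v m n → inst (S^ m v) c0 c0 ck ≡ inst (S^ n v) c0 c0 ck →
             inst v c0 c0 ck ≡ c0 → m ≡ n
  exponent v m n e v↦0 rewrite inst-S^ m v c0 c0 ck | inst-S^ n v c0 c0 ck | v↦0 =
    S^-injective m n e

sim-complete : ∀ {a b} → IsSemitable a → IsSemitable b →
               ⊨ SimT (inst a c0 c0 ck) (inst b c0hat c0tilde cktilde) → a ≡ b
sim-complete {a} {b} sa sb sim = inst-injective sa sb (begin
  inst a c0 c0 ck                              ≡⟨ sym (semitable-fixed var sa) ⟩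
  eval Collapse var (inst a c0 c0 ck)          ≡⟨ sim Collapse var (refl , refl , refl) ⟩
  eval Collapse var (inst b c0hat c0tilde cktilde)
    ≡⟨ sym (sim-sound b Collapse var (refl , refl , refl)) ⟩
  eval Collapse var (inst b c0 c0 ck)          ≡⟨ semitable-fixed var sb ⟩
  inst b c0 c0 ck                              ∎)
  where open ≡-Reasoning

lemma5p13 : (a b : Term) → IsSemitable a → IsSemitable b →
    ((⊨ SimT (inst a c0 c0 ck) (inst b c0hat c0tilde cktilde)) ⇔ (a ≡ b))
lemma5p13 a b sa sb = mk⇔ (sim-complete sa sb) λ { refl → sim-sound a }
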